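{- For every positive integer $t$ and every even positive integer $d$, there is a graph $G$ of maximum degree $d$ such that $\chi(G^t)\ge d^t/2^t$. Moreover, $G$ can be chosen to have girth $4$ if $t\notin\{1,3\}$, and also to be bipartite if $t$ is even.
   Context: For a positive integer $t$, the $t$-th power $G^t$ of a simple graph $G=(V,E)$ is the graph on $V$ in which two distinct vertices are adjacent iff they are joined by a path of length at most $t$ in $G$. -}

module Defs where

open import Data.Nat using (ℕ; zero; suc; _+_; _*_; _^_; _≤_; _<_)
open import Data.Fin using (Fin)
open import Data.Bool using (Bool; true; false; if_then_else_)
open import Data.List using (List; []; _∷_; map; allFin)
open import Data.Nat.ListAction using (sum)
open import Relation.Nullary using (¬_)
open import Data.List.Relation.Unary.Unique.Propositional using (Unique)
open import Data.Product using (Σ; _×_; ∃; ∃-syntax)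
open import Relation.Binary.PropositionalEquality using (_≡_; _≢_)

record Graph (n : ℕ) : Set where
  field
    adj   : Fin n → Fin n → Bool
    sym   : ∀ u v → adj u v ≡ adj v u
    irrefl : ∀ v → adj v v ≡ false

open Graph public

module _ {n : ℕ} (G : Graph n) where

  Adj : Fin n → Fin n → Set
  Adj u v = adj G u v ≡ true

  degree : Fin n → ℕ
  degree v = sum (map (λ u → if adj G v u then 1 else 0) (allFin n))

  MaxDegree : ℕ → Set
  MaxDegree d = (∀ v → degree v ≤ d) × (∃[ v ] degree v ≡ d)

  data Walk : Fin n → Fin n → ℕ → Set where
    nil  : ∀ u → Walk u u 0
    cons : ∀ {u w v k} → Adj u w → Walk w v k → Walk u v (suc k)

  verts : ∀ {u v k} → Walk u v k → List (Fin n)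
  verts (nil u) = u ∷ []
  verts (cons {u = u} _ p) = u ∷ verts p

  IsPath : ∀ {u v k} → Walk u v k → Set
  IsPath p = Unique (verts p)

  -- a cycle of length k: k ≥ 3 and a closed walk u → u of length k whose
  -- vertices other than the repeated endpoint are pairwise distinct
  tailVerts : ∀ {u v k} → Walk u v k → List (Fin n)
  tailVerts (nil u) = []
  tailVerts (cons _ p) = verts p

  HasCycleOfLength : ℕ → Set
  HasCycleOfLength k = 3 ≤ k × (∃[ u ] Σ (Walk u u k) (λ p → Unique (tailVerts p)))

  Girth : ℕ → Set
  Girth g = HasCycleOfLength g × (∀ k → k < g → ¬ HasCycleOfLength k)

  Bipartite : Set
  Bipartite = Σ (Fin n → Bool) (λ c → ∀ u v → Adj u v → c u ≢ c v)

  PowAdj : ℕ → Fin n → Fin n → Set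
  PowAdj t u v = u ≢ v × (∃[ k ] (k ≤ t × Σ (Walk u v k) IsPath))

ProperColouring : {n m : ℕ} → (Fin n → Fin n → Set) → (Fin n → Fin m) → Set
ProperColouring R c = ∀ u v → R u v → c u ≢ c v

-- χ(R) ≥ a / b  (rational lower bound, b > 0): every proper colouring with
-- m colours satisfies m ≥ a / b, i.e. a ≤ b * m
ChromaticAtLeast : {n : ℕ} → (Fin n → Fin n → Set) → ℕ → ℕ → Set
ChromaticAtLeast {n} R a b = ∀ m (c : Fin n → Fin m) → ProperColouring R c → a ≤ b * m

-- Let k = d/2. Take t layers indexed by ℤ/t, each a copy of [k]^t, and join (i, x) to (i + 1, y)
-- whenever y differs from x at most in coordinate i. A vertex has at most k neighbours in each of
-- the two adjacent layers, so its degree is at most d. Two distinct words x, y of layer 0 are joined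
-- by the walk of length t that rewrites coordinates 0, 1, …, t − 1 in turn, so layer 0 is a clique
-- of size k^t = d^t / 2^t in G^t. Around a triangle the layer index would move by ±1 three times and
-- return, forcing t ∣ 1 or t ∣ 3; for even t the parity of the layer is a proper 2-colouring.
-- A disjoint copy of K_{d,d} makes the maximum degree exactly d and supplies a 4-cycle.

module Submission where

open import Defs hiding (sym)
open import Data.Bool using (Bool; true; false; not; if_then_else_)
open import Data.Bool.Properties using (¬-not; not-¬) renaming (_≟_ to _≟ᵇ_)
open import Data.Empty using (⊥)
open import Data.Fin using (Fin; zero; suc; toℕ)
open import Data.Fin.Properties using (_≟_; toℕ-fromℕ<; toℕ<n; toℕ-injective; injective⇒≤; *↔×; +↔⊎; 2↔Bool)
open import Data.List using (List; []; _∷_; map; filter; allFin; length; _++_)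
open import Data.List.Membership.Propositional using (_∈_)
open import Data.List.Membership.Propositional.Properties using (∈-filter⁺; ∈-filter⁻; ∈-allFin; ∈-map⁺; ∈-map⁻; ∈-++⁺ˡ; ∈-++⁺ʳ)
open import Data.List.Properties using (length-removeAt′; length-map; length-++; length-tabulate)
open import Data.List.Relation.Binary.Subset.Propositional using (_⊆_)
open import Data.List.Relation.Unary.All using ([]; _∷_)
import Data.List.Relation.Unary.All as All
open import Data.List.Relation.Unary.All.Properties using (¬Any⇒All¬)
open import Data.List.Relation.Unary.AllPairs using ([]; _∷_)
open import Data.List.Relation.Unary.Any using (here; there; index; _─_)
open import Data.List.Relation.Unary.Unique.Propositional using (Unique)
open import Data.List.Relation.Unary.Unique.Propositional.Properties using (filter⁺; allFin⁺) renaming (map⁺ to unique-map⁺)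
open import Data.Nat using (ℕ; zero; suc; _+_; _*_; _^_; _≤_; _<_; z≤n; s≤s; z<s; s<s; NonZero; parity)
open import Data.Nat.DivMod using (_%_; _/_; _mod_; m%n<n; m%n%n≡m%n; %-distribˡ-+; [m+n]%n≡m%n; m<n⇒m%n≡m; m≡m%n+[m/n]*n; n%n≡0)
open import Data.Nat.Divisibility using (_∣_; divides; ∣1⇒≡1)
open import Data.Nat.GeneralisedArithmetic using (iterate)
open import Data.Nat.ListAction using (sum)
open import Data.Nat.Primality using (Irreducible; irreducible?)
open import Data.Nat.Properties using (≤-refl; ≤-trans; <⇒≤; ≤-pred; ≤∧≢⇒<; ≤-antisym; m≤n⇒m≤1+n; +-cancelˡ-≡; +-identityʳ; +-suc; +-comm; *-comm; *-monoˡ-≤; *-commutativeSemigroup; module ≤-Reasoning)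
open import Algebra.Properties.CommutativeSemigroup *-commutativeSemigroup using (interchange)
open import Data.Parity.Base as ℙ using (Parity; 0ℙ; 1ℙ; _⁻¹)
open import Data.Parity.Properties using (+-homo-+; *-homo-*; suc-homo-⁻¹; ⁻¹-selfInverse) renaming (*-zeroʳ to ℙ*-zeroʳ; +-identityʳ to ℙ+-identityʳ)
open import Data.Product using (Σ; ∃-syntax; _×_; _,_; proj₁; proj₂; uncurry)
open import Data.Product.Function.NonDependent.Propositional using (_×-↔_)
open import Data.Product.Properties using () renaming (≡-dec to ×-≡-dec)
open import Data.Sum using (_⊎_; inj₁; inj₂; [_,_])
open import Data.Sum.Properties using (inj₂-injective)
import Data.Sum as Sum
open import Data.Sum.Function.Propositional using (_⊎-↔_)
open import Data.Vec using (Vec; []; _∷_; uncons; lookup; _[_]≔_)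
open import Data.Vec.Properties using (lookup∘update; lookup∘update′; []≔-idempotent; []≔-lookup) renaming (≡-dec to vec-≡-dec)
open import Data.Vec.Relation.Binary.Pointwise.Extensional using (ext; Pointwise-≡⇒≡)
open import Function using (id; _∘_)
open import Function.Bundles using (_↔_; Inverse; Injection; mk↔ₛ′; mk⇔)
open import Function.Properties.Inverse using (↔-refl; ↔-sym; ↔-trans; ↔⇒↣)
open import Relation.Binary.PropositionalEquality using (_≡_; _≢_; refl; sym; trans; cong; cong₂; subst; subst₂; ≢-sym; module ≡-Reasoning)
open import Relation.Nullary using (¬_; Dec; yes; no; does; proof; ¬?; contradiction)
open import Relation.Nullary.Decidable using (dec-true; dec-false; does-⇔; from-yes; _×-dec_; _⊎-dec_)
open import Relation.Nullary.Reflects using (Reflects; invert)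

^-distribʳ-* : ∀ m n o → (m * n) ^ o ≡ m ^ o * n ^ o
^-distribʳ-* m n zero    = refl
^-distribʳ-* m n (suc o) = trans (cong (m * n *_) (^-distribʳ-* m n o)) (interchange m n (m ^ o) (n ^ o))

[m%n+o]%n≡[m+o]%n : ∀ m o n .{{_ : NonZero n}} → (m % n + o) % n ≡ (m + o) % n
[m%n+o]%n≡[m+o]%n m o n = begin
  (m % n + o) % n         ≡⟨ %-distribˡ-+ (m % n) o n ⟩
  (m % n % n + o % n) % n ≡⟨ cong (λ a → (a + o % n) % n) (m%n%n≡m%n m n) ⟩
  (m % n + o % n) % n     ≡⟨ %-distribˡ-+ m o n ⟨
  (m + o) % n             ∎
  where open ≡-Reasoning

[m+o]%n≡m⇒n∣o : ∀ m o n .{{_ : NonZero n}} → (m + o) % n ≡ m → n ∣ o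
[m+o]%n≡m⇒n∣o m o n eq = divides ((m + o) / n) (+-cancelˡ-≡ m o _ (begin
  m + o                         ≡⟨ m≡m%n+[m/n]*n (m + o) n ⟩
  (m + o) % n + (m + o) / n * n ≡⟨ cong (_+ (m + o) / n * n) eq ⟩
  m + (m + o) / n * n           ∎))
  where open ≡-Reasoning

parity-% : ∀ m n .{{_ : NonZero n}} → 2 ∣ n → parity (m % n) ≡ parity m
parity-% m n (divides q refl) = sym (begin
  parity m                                           ≡⟨ cong parity (m≡m%n+[m/n]*n m n) ⟩
  parity (m % n + m / n * n)                         ≡⟨ +-homo-+ (m % n) (m / n * n) ⟩
  parity (m % n) ℙ.+ parity (m / n * (q * 2))        ≡⟨ cong (parity (m % n) ℙ.+_) n-even ⟩
  parity (m % n) ℙ.+ 0ℙ                              ≡⟨ ℙ+-identityʳ (parity (m % n)) ⟩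
  parity (m % n)                                     ∎)
  where
  open ≡-Reasoning
  n-even : parity (m / n * (q * 2)) ≡ 0ℙ
  n-even = begin
    parity (m / n * (q * 2))              ≡⟨ *-homo-* (m / n) (q * 2) ⟩
    parity (m / n) ℙ.* parity (q * 2)     ≡⟨ cong (parity (m / n) ℙ.*_) (*-homo-* q 2) ⟩
    parity (m / n) ℙ.* (parity q ℙ.* 0ℙ)  ≡⟨ cong (parity (m / n) ℙ.*_) (ℙ*-zeroʳ (parity q)) ⟩
    parity (m / n) ℙ.* 0ℙ                 ≡⟨ ℙ*-zeroʳ (parity (m / n)) ⟩
    0ℙ                                    ∎

module _ {A : Set} where

  ∈-─ : ∀ {x z : A} {ys} (x∈ys : x ∈ ys) → z ∈ ys → z ≢ x → z ∈ (ys ─ x∈ys)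
  ∈-─ (here refl)  (here refl)  z≢x = contradiction refl z≢x
  ∈-─ (here _)     (there z∈ys) _   = z∈ys
  ∈-─ (there _)    (here refl)  _   = here refl
  ∈-─ (there x∈ys) (there z∈ys) z≢x = there (∈-─ x∈ys z∈ys z≢x)

  unique-⊆⇒length≤ : ∀ {xs ys : List A} → Unique xs → xs ⊆ ys → length xs ≤ length ys
  unique-⊆⇒length≤ {[]}     _               _     = z≤n
  unique-⊆⇒length≤ {x ∷ xs} {ys} (x∉xs ∷ xs!) xs⊆ys = begin
    suc (length xs)          ≤⟨ s≤s (unique-⊆⇒length≤ xs! xs⊆ys─x) ⟩
    suc (length (ys ─ x∈ys)) ≡⟨ length-removeAt′ ys (index x∈ys) ⟨
    length ys                ∎
    where
    open ≤-Reasoning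
    x∈ys : x ∈ ys
    x∈ys = xs⊆ys (here refl)
    xs⊆ys─x : xs ⊆ (ys ─ x∈ys)
    xs⊆ys─x z∈xs = ∈-─ x∈ys (xs⊆ys (there z∈xs)) (≢-sym (All.lookup x∉xs z∈xs))

  sum-indicator≡length-filter : ∀ (f : A → Bool) xs →
    sum (map (λ x → if f x then 1 else 0) xs) ≡ length (filter (λ x → f x ≟ᵇ true) xs)
  sum-indicator≡length-filter f []       = refl
  sum-indicator≡length-filter f (x ∷ xs) with f x
  ... | true  = cong suc (sum-indicator≡length-filter f xs)
  ... | false = sum-indicator≡length-filter f xs

length-map-allFin : ∀ {A : Set} {n} (f : Fin n → A) → length (map f (allFin n)) ≡ n
length-map-allFin {n = n} f = trans (length-map f (allFin n)) (length-tabulate (λ i → i))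

[]≔-swap : ∀ {A : Set} {n} {x y : Vec A n} {i a} → x ≡ y [ i ]≔ a → y ≡ x [ i ]≔ lookup y i
[]≔-swap {y = y} {i} refl = sym (trans ([]≔-idempotent y i) ([]≔-lookup y i))

Vec↔Fin^ : ∀ k n → Vec (Fin k) n ↔ Fin (k ^ n)
Vec↔Fin^ k zero    = mk↔ₛ′ (λ _ → zero) (λ _ → []) (λ { zero → refl }) (λ { [] → refl })
Vec↔Fin^ k (suc n) = ↔-trans uncons↔ (↔-trans (↔-refl ×-↔ Vec↔Fin^ k n) (↔-sym *↔×))
  where
  uncons↔ : Vec (Fin k) (suc n) ↔ (Fin k × Vec (Fin k) n)
  uncons↔ = mk↔ₛ′ uncons (uncurry _∷_) (λ _ → refl) (λ { (_ ∷ _) → refl })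

module _ {n : ℕ} (G : Graph n) where

  open import Data.List.Membership.DecPropositional (_≟_ {n}) using (_∈?_)

  Adj? : ∀ v u → Dec (Adj G v u)
  Adj? v u = adj G v u ≟ᵇ true

  degree≤length : ∀ v (L : List (Fin n)) → (∀ {u} → Adj G v u → u ∈ L) → degree G v ≤ length L
  degree≤length v L N⊆L = subst (_≤ length L) (sym (sum-indicator≡length-filter (adj G v) (allFin n)))
    (unique-⊆⇒length≤ (filter⁺ (Adj? v) (allFin⁺ n)) (λ u∈N → N⊆L (proj₂ (∈-filter⁻ (Adj? v) {xs = allFin n} u∈N))))

  length≤degree : ∀ v (L : List (Fin n)) → Unique L → (∀ {u} → u ∈ L → Adj G v u) → length L ≤ degree G v
  length≤degree v L L! L⊆N = subst (length L ≤_) (sym (sum-indicator≡length-filter (adj G v) (allFin n)))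
    (unique-⊆⇒length≤ L! (λ {u} u∈L → ∈-filter⁺ (Adj? v) (∈-allFin u) (L⊆N u∈L)))

  walk-suffix : ∀ {u w v k} (p : Walk G w v k) → u ∈ verts G p →
    ∃[ k′ ] k′ ≤ k × Σ (Walk G u v k′) (λ q → IsPath G p → IsPath G q)
  walk-suffix (nil _)    (here refl) = 0 , z≤n , nil _ , id
  walk-suffix (cons e p) (here refl) = _ , ≤-refl , cons e p , id
  walk-suffix (cons _ p) (there u∈p) with walk-suffix p u∈p
  ... | k′ , k′≤k , q , q-path = k′ , m≤n⇒m≤1+n k′≤k , q , λ { (_ ∷ p-path) → q-path p-path }

  walk⇒path : ∀ {u v k} → Walk G u v k → ∃[ k′ ] k′ ≤ k × Σ (Walk G u v k′) (IsPath G)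
  walk⇒path (nil u) = 0 , z≤n , nil u , [] ∷ []
  walk⇒path {u} (cons e p) with walk⇒path p
  ... | k′ , k′≤k , q , q-path with u ∈? verts G q
  ...   | yes u∈q = let k″ , k″≤k′ , r , r-path = walk-suffix q u∈q
                    in k″ , m≤n⇒m≤1+n (≤-trans k″≤k′ k′≤k) , r , r-path q-path
  ...   | no  u∉q = suc k′ , s≤s k′≤k , cons e q , ¬Any⇒All¬ (verts G q) u∉q ∷ q-path

  chain⇒walk : (f : ℕ → Fin n) (m : ℕ) → (∀ j → j < m → f j ≡ f (suc j) ⊎ Adj G (f j) (f (suc j))) →
    ∃[ k ] k ≤ m × Walk G (f 0) (f m) k
  chain⇒walk f zero    _    = 0 , z≤n , nil (f 0)
  chain⇒walk f (suc m) step with step 0 z<s | chain⇒walk (f ∘ suc) m (λ j j<m → step (suc j) (s<s j<m))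
  ... | inj₁ f0≡f1 | k , k≤m , w = k , m≤n⇒m≤1+n k≤m , subst (λ u → Walk G u (f (suc m)) k) (sym f0≡f1) w
  ... | inj₂ e     | k , k≤m , w = suc k , s≤s k≤m , cons e w

module RelationGraph {V : Set} {N : ℕ} (code : V ↔ Fin N) {R : V → V → Set}
    (R? : ∀ p q → Dec (R p q)) (R-sym : ∀ {p q} → R p q → R q p) (R-irrefl : ∀ {p} → ¬ R p p) where

  open Inverse code

  graph : Graph N
  graph = record
    { adj    = λ u v → does (R? (from u) (from v))
    ; sym    = λ u v → does-⇔ (mk⇔ R-sym R-sym) (R? (from u) (from v)) (R? (from v) (from u))
    ; irrefl = λ v → dec-false (R? (from v) (from v)) R-irrefl
    }

  Adj⇒R : ∀ {u v} → Adj graph u v → R (from u) (from v)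
  Adj⇒R {u} {v} e = invert (subst (Reflects _) e (proof (R? (from u) (from v))))

  R⇒Adj : ∀ {p q} → R p q → Adj graph (to p) (to q)
  R⇒Adj {p} {q} r = dec-true (R? (from (to p)) (from (to q)))
    (subst₂ R (sym (strictlyInverseʳ p)) (sym (strictlyInverseʳ q)) r)

clique-size≤colours : ∀ {n s m} {R : Fin n → Fin n → Set} (f : Fin s → Fin n) →
  (∀ {i j} → i ≢ j → R (f i) (f j)) → (c : Fin n → Fin m) → ProperColouring R c → s ≤ m
clique-size≤colours f clique c proper = injective⇒≤ c∘f-injective
  where
  c∘f-injective : ∀ {i j} → c (f i) ≡ c (f j) → i ≡ j
  c∘f-injective {i} {j} same with i ≟ j
  ... | yes i≡j = i≡j
  ... | no  i≢j = contradiction same (proper _ _ (clique i≢j))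

module Cycle (t′ : ℕ) where

  open ≡-Reasoning

  t : ℕ
  t = suc t′

  next : Fin t → Fin t
  next i = suc (toℕ i) mod t

  prev : Fin t → Fin t
  prev i = iterate next i t′

  toℕ-mod : ∀ m → toℕ (m mod t) ≡ m % t
  toℕ-mod m = toℕ-fromℕ< (m%n<n m t)

  next-mod : ∀ m → next (m mod t) ≡ suc m mod t
  next-mod m = toℕ-injective (begin
    toℕ (next (m mod t))      ≡⟨ toℕ-mod (suc (toℕ (m mod t))) ⟩
    suc (toℕ (m mod t)) % t   ≡⟨ cong (λ a → a % t) (trans (cong suc (toℕ-mod m)) (+-comm 1 (m % t))) ⟩
    (m % t + 1) % t           ≡⟨ [m%n+o]%n≡[m+o]%n m 1 t ⟩
    (m + 1) % t               ≡⟨ cong (_% t) (+-comm m 1) ⟩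
    suc m % t                 ≡⟨ toℕ-mod (suc m) ⟨
    toℕ (suc m mod t)         ∎)

  mod-self : t mod t ≡ zero
  mod-self = toℕ-injective (trans (toℕ-mod t) (n%n≡0 t))

  toℕ-iterate-next : ∀ r i → toℕ (iterate next i r) ≡ (toℕ i + r) % t
  toℕ-iterate-next zero i = sym (trans (cong (_% t) (+-identityʳ (toℕ i))) (m<n⇒m%n≡m (toℕ<n i)))
  toℕ-iterate-next (suc r) i = begin
    toℕ (iterate next (next i) r) ≡⟨ toℕ-iterate-next r (next i) ⟩
    (toℕ (next i) + r) % t        ≡⟨ cong (λ a → (a + r) % t) (toℕ-mod (suc (toℕ i))) ⟩
    (suc (toℕ i) % t + r) % t     ≡⟨ [m%n+o]%n≡[m+o]%n (suc (toℕ i)) r t ⟩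
    (suc (toℕ i) + r) % t         ≡⟨ cong (_% t) (+-suc (toℕ i) r) ⟨
    (toℕ i + suc r) % t           ∎

  iterate-next≡⇒t∣ : ∀ r i → iterate next i r ≡ i → t ∣ r
  iterate-next≡⇒t∣ r i eq = [m+o]%n≡m⇒n∣o (toℕ i) r t
    (trans (sym (toℕ-iterate-next r i)) (cong toℕ eq))

  prev-next : ∀ i → prev (next i) ≡ i
  prev-next i = toℕ-injective (begin
    toℕ (iterate next i t) ≡⟨ toℕ-iterate-next t i ⟩
    (toℕ i + t) % t        ≡⟨ [m+n]%n≡m%n (toℕ i) t ⟩
    toℕ i % t              ≡⟨ m<n⇒m%n≡m (toℕ<n i) ⟩
    toℕ i                  ∎)

  next-injective : ∀ {i j} → next i ≡ next j → i ≡ j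
  next-injective {i} {j} eq = trans (sym (prev-next i)) (trans (cong prev eq) (prev-next j))

  Consecutive : Fin t → Fin t → Set
  Consecutive i j = j ≡ next i ⊎ i ≡ next j

  no-fixpoint : t ≢ 1 → ∀ i → next i ≢ i
  no-fixpoint t≢1 i = t≢1 ∘ ∣1⇒≡1 ∘ iterate-next≡⇒t∣ 1 i

  no-3-cycle : t ≢ 1 → t ≢ 3 → ∀ i → next (next (next i)) ≢ i
  no-3-cycle t≢1 t≢3 i = [ t≢1 , t≢3 ] ∘ irreducible[3] ∘ iterate-next≡⇒t∣ 3 i
    where
    irreducible[3] : Irreducible 3
    irreducible[3] = from-yes (irreducible? 3)

  parity-next : 2 ∣ t → ∀ i → parity (toℕ (next i)) ≡ parity (toℕ i) ⁻¹
  parity-next 2∣t i = begin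
    parity (toℕ (next i))    ≡⟨ cong parity (toℕ-mod (suc (toℕ i))) ⟩
    parity (suc (toℕ i) % t) ≡⟨ parity-% (suc (toℕ i)) t 2∣t ⟩
    parity (suc (toℕ i))     ≡⟨ ⁻¹-selfInverse (suc-homo-⁻¹ (toℕ i)) ⟨
    parity (toℕ i) ⁻¹        ∎

  triangle-free : t ≢ 1 → t ≢ 3 → ∀ {i j l} → Consecutive i j → Consecutive j l → Consecutive l i → ⊥
  triangle-free t≢1 t≢3 (inj₁ refl) (inj₁ refl) (inj₁ e) = no-3-cycle t≢1 t≢3 _ (sym e)
  triangle-free t≢1 t≢3 (inj₁ refl) (inj₁ refl) (inj₂ e) = no-fixpoint t≢1 _ (next-injective e)
  triangle-free t≢1 t≢3 (inj₁ refl) (inj₂ e) (inj₁ refl) = no-fixpoint t≢1 _ (next-injective e)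
  triangle-free t≢1 t≢3 (inj₁ refl) (inj₂ e) (inj₂ refl) = no-fixpoint t≢1 _ (next-injective (sym e))
  triangle-free t≢1 t≢3 (inj₂ refl) (inj₁ refl) (inj₁ e) = no-fixpoint t≢1 _ (next-injective (sym e))
  triangle-free t≢1 t≢3 (inj₂ refl) (inj₁ refl) (inj₂ e) = no-fixpoint t≢1 _ (next-injective (sym e))
  triangle-free t≢1 t≢3 (inj₂ refl) (inj₂ refl) (inj₁ e) = no-fixpoint t≢1 _ (next-injective e)
  triangle-free t≢1 t≢3 (inj₂ refl) (inj₂ refl) (inj₂ e) = no-3-cycle t≢1 t≢3 _ (sym e)

module Construction (t′ k′ : ℕ) where

  open Cycle t′ public

  k d N : ℕ
  k = suc k′
  d = k * 2
  N = t * k ^ t + 2 * d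

  Layered : Set
  Layered = Fin t × Vec (Fin k) t

  V : Set
  V = Layered ⊎ (Bool × Fin d)

  code : V ↔ Fin N
  code = ↔-trans (layered ⊎-↔ complete) (↔-sym +↔⊎)
    where
    layered : Layered ↔ Fin (t * k ^ t)
    layered = ↔-trans (↔-refl ×-↔ Vec↔Fin^ k t) (↔-sym *↔×)
    complete : (Bool × Fin d) ↔ Fin (2 * d)
    complete = ↔-trans (↔-sym 2↔Bool ×-↔ ↔-refl) (↔-sym *↔×)

  open Inverse code using (to; from; strictlyInverseˡ)

  to-injective : ∀ {p q} → to p ≡ to q → p ≡ q
  to-injective = Injection.injective (↔⇒↣ code)

  Step : Layered → Layered → Set
  Step (i , x) (j , y) = j ≡ next i × y ≡ x [ i ]≔ lookup y i

  -- The condition p ≢ q only bites for t = 1, where a step may change nothing.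
  Edge : V → V → Set
  Edge (inj₁ p)       (inj₁ q)       = (Step p q ⊎ Step q p) × p ≢ q
  Edge (inj₁ _)       (inj₂ _)       = ⊥
  Edge (inj₂ _)       (inj₁ _)       = ⊥
  Edge (inj₂ (a , _)) (inj₂ (b , _)) = a ≢ b

  _≟ₗ_ : ∀ (p q : Layered) → Dec (p ≡ q)
  _≟ₗ_ = ×-≡-dec _≟_ (vec-≡-dec _≟_)

  Step? : ∀ p q → Dec (Step p q)
  Step? (i , x) (j , y) = (j ≟ next i) ×-dec vec-≡-dec _≟_ y (x [ i ]≔ lookup y i)

  Edge? : ∀ p q → Dec (Edge p q)
  Edge? (inj₁ p)       (inj₁ q)       = (Step? p q ⊎-dec Step? q p) ×-dec ¬? (p ≟ₗ q)
  Edge? (inj₁ _)       (inj₂ _)       = no λ ()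
  Edge? (inj₂ _)       (inj₁ _)       = no λ ()
  Edge? (inj₂ (a , _)) (inj₂ (b , _)) = ¬? (a ≟ᵇ b)

  Edge-sym : ∀ {p q} → Edge p q → Edge q p
  Edge-sym {inj₁ _} {inj₁ _} (s , p≢q) = Sum.swap s , ≢-sym p≢q
  Edge-sym {inj₂ _} {inj₂ _} a≢b       = ≢-sym a≢b

  Edge-irrefl : ∀ {p} → ¬ Edge p p
  Edge-irrefl {inj₁ _} (_ , p≢p) = p≢p refl
  Edge-irrefl {inj₂ _} a≢a       = a≢a refl

  open RelationGraph code Edge? Edge-sym Edge-irrefl public renaming (graph to G)

  forward backward : Fin t → Vec (Fin k) t → Fin k → Fin N
  forward  i x a = to (inj₁ (next i , x [ i ]≔ a))
  backward i x a = to (inj₁ (prev i , x [ prev i ]≔ a))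

  across : Bool → Fin d → Fin N
  across b a = to (inj₂ (not b , a))

  neighbourList : V → List (Fin N)
  neighbourList (inj₁ (i , x)) = map (forward i x) (allFin k) ++ map (backward i x) (allFin k)
  neighbourList (inj₂ (b , _)) = map (across b) (allFin d)

  length-neighbourList : ∀ p → length (neighbourList p) ≡ d
  length-neighbourList (inj₁ (i , x)) = begin
    length (map (forward i x) (allFin k) ++ map (backward i x) (allFin k))
      ≡⟨ length-++ (map (forward i x) (allFin k)) ⟩
    length (map (forward i x) (allFin k)) + length (map (backward i x) (allFin k))
      ≡⟨ cong₂ _+_ (length-map-allFin (forward i x)) (length-map-allFin (backward i x)) ⟩
    k + k      ≡⟨ cong (k +_) (+-identityʳ k) ⟨
    2 * k      ≡⟨ *-comm 2 k ⟩
    k * 2      ∎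
    where open ≡-Reasoning
  length-neighbourList (inj₂ (b , _)) = length-map-allFin (across b)

  Edge⇒∈neighbourList : ∀ p q → Edge p q → to q ∈ neighbourList p
  Edge⇒∈neighbourList (inj₁ (i , x)) (inj₁ (_ , y)) (inj₁ (refl , y≡) , _) =
    subst (λ z → to (inj₁ (next i , z)) ∈ neighbourList (inj₁ (i , x))) (sym y≡)
      (∈-++⁺ˡ (∈-map⁺ (forward i x) (∈-allFin (lookup y i))))
  Edge⇒∈neighbourList (inj₁ (_ , x)) (inj₁ (j , y)) (inj₂ (refl , x≡) , _) =
    subst (_∈ neighbourList (inj₁ (next j , x))) (cong (to ∘ inj₁) back)
      (∈-++⁺ʳ (map (forward (next j) x) (allFin k)) (∈-map⁺ (backward (next j) x) (∈-allFin (lookup y j))))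
    where
    back : (prev (next j) , x [ prev (next j) ]≔ lookup y j) ≡ (j , y)
    back rewrite prev-next j = cong (j ,_) (sym ([]≔-swap x≡))
  Edge⇒∈neighbourList (inj₂ (a , α)) (inj₂ (b , β)) a≢b =
    subst (λ c → to (inj₂ (c , β)) ∈ neighbourList (inj₂ (a , α))) (sym (¬-not (≢-sym a≢b)))
      (∈-map⁺ (across a) (∈-allFin β))

  across-unique : ∀ b → Unique (map (across b) (allFin d))
  across-unique b = unique-map⁺ across-injective (allFin⁺ d)
    where
    across-injective : ∀ {a a′} → across b a ≡ across b a′ → a ≡ a′
    across-injective {a} {a′} e = cong proj₂ (inj₂-injective (to-injective {inj₂ (not b , a)} {inj₂ (not b , a′)} e))

  across-Adj : ∀ b α {u} → u ∈ map (across b) (allFin d) → Adj G (to (inj₂ (b , α))) u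
  across-Adj b α u∈ with ∈-map⁻ (across b) u∈
  ... | a , _ , refl = R⇒Adj {inj₂ (b , α)} {inj₂ (not b , a)} (not-¬ refl)

  maxDegree : MaxDegree G d
  maxDegree = degree≤d , v₀ , ≤-antisym (degree≤d v₀) d≤degree-v₀
    where
    degree≤d : ∀ v → degree G v ≤ d
    degree≤d v = subst (degree G v ≤_) (length-neighbourList (from v))
      (degree≤length G v (neighbourList (from v))
        (λ {u} e → subst (_∈ neighbourList (from v)) (strictlyInverseˡ u) (Edge⇒∈neighbourList _ _ (Adj⇒R e))))
    v₀ : Fin N
    v₀ = to (inj₂ (true , zero))
    d≤degree-v₀ : d ≤ degree G v₀
    d≤degree-v₀ = subst (_≤ degree G v₀) (length-neighbourList (inj₂ (true , zero)))
      (length≤degree G v₀ (map (across true) (allFin d)) (across-unique true) (across-Adj true zero))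

  origin : Vec (Fin k) t → Fin N
  origin x = to (inj₁ (zero , x))

  origin-injective : ∀ {x y} → origin x ≡ origin y → x ≡ y
  origin-injective {x} {y} e with to-injective {inj₁ (zero , x)} {inj₁ (zero , y)} e
  ... | refl = refl

  module _ (x y : Vec (Fin k) t) where

    hybrid : ℕ → Vec (Fin k) t
    hybrid zero    = x
    hybrid (suc j) = hybrid j [ j mod t ]≔ lookup y (j mod t)

    lookup-hybrid : ∀ j c → j ≤ t → toℕ c < j → lookup (hybrid j) c ≡ lookup y c
    lookup-hybrid (suc j) c j<t c<1+j with j mod t ≟ c
    ... | yes refl = lookup∘update (j mod t) (hybrid j) (lookup y (j mod t))
    ... | no  j≢c  = trans untouched (lookup-hybrid j c (<⇒≤ j<t) (≤∧≢⇒< (≤-pred c<1+j) c≢j))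
      where
      untouched : lookup (hybrid j [ j mod t ]≔ lookup y (j mod t)) c ≡ lookup (hybrid j) c
      untouched = lookup∘update′ (≢-sym j≢c) (hybrid j) (lookup y (j mod t))
      c≢j : toℕ c ≢ j
      c≢j c≡j = j≢c (toℕ-injective (trans (trans (toℕ-mod j) (m<n⇒m%n≡m j<t)) (sym c≡j)))

    hybrid-t : hybrid t ≡ y
    hybrid-t = Pointwise-≡⇒≡ (ext λ c → lookup-hybrid t c ≤-refl (toℕ<n c))

    hybrid-Step : ∀ j → Step (j mod t , hybrid j) (suc j mod t , hybrid (suc j))
    hybrid-Step j = sym (next-mod j)
                  , cong (hybrid j [ j mod t ]≔_) (sym (lookup∘update (j mod t) (hybrid j) (lookup y (j mod t))))

    hybrid-chain : ∀ j → to (inj₁ (j mod t , hybrid j)) ≡ to (inj₁ (suc j mod t , hybrid (suc j)))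
                       ⊎ Adj G (to (inj₁ (j mod t , hybrid j))) (to (inj₁ (suc j mod t , hybrid (suc j))))
    hybrid-chain j with (j mod t , hybrid j) ≟ₗ (suc j mod t , hybrid (suc j))
    ... | yes same   = inj₁ (cong (to ∘ inj₁) same)
    ... | no  differ = inj₂ (R⇒Adj (inj₁ (hybrid-Step j) , differ))

    origin-PowAdj : x ≢ y → PowAdj G t (origin x) (origin y)
    origin-PowAdj x≢y =
      let k₁ , k₁≤t , w = chain⇒walk G (λ j → to (inj₁ (j mod t , hybrid j))) t (λ j _ → hybrid-chain j)
          k₂ , k₂≤k₁ , p = walk⇒path G (subst (λ v → Walk G (origin x) v k₁) end w)
      in x≢y ∘ origin-injective , k₂ , ≤-trans k₂≤k₁ k₁≤t , p
      where
      end : to (inj₁ (t mod t , hybrid t)) ≡ origin y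
      end = cong (to ∘ inj₁) (cong₂ _,_ mod-self hybrid-t)

  chromatic : ChromaticAtLeast (PowAdj G t) (d ^ t) (2 ^ t)
  chromatic m c proper = begin
    d ^ t          ≡⟨ ^-distribʳ-* k 2 t ⟩
    k ^ t * 2 ^ t  ≤⟨ *-monoˡ-≤ (2 ^ t) (clique-size≤colours (origin ∘ word) (origin-PowAdj _ _ ∘ word-≢) c proper) ⟩
    m * 2 ^ t      ≡⟨ *-comm m (2 ^ t) ⟩
    2 ^ t * m      ∎
    where
    open ≤-Reasoning
    word : Fin (k ^ t) → Vec (Fin k) t
    word = Inverse.from (Vec↔Fin^ k t)
    word-≢ : ∀ {i j} → i ≢ j → word i ≢ word j
    word-≢ i≢j = i≢j ∘ Injection.injective (↔⇒↣ (↔-sym (Vec↔Fin^ k t)))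

  Edge-triangle-free : t ≢ 1 → t ≢ 3 → ∀ p q r → Edge p q → Edge q r → Edge r p → ⊥
  Edge-triangle-free t≢1 t≢3 (inj₁ _) (inj₁ _) (inj₁ _) (pq , _) (qr , _) (rp , _) =
    triangle-free t≢1 t≢3 (Sum.map proj₁ proj₁ pq) (Sum.map proj₁ proj₁ qr) (Sum.map proj₁ proj₁ rp)
  Edge-triangle-free _ _ (inj₂ _) (inj₂ _) (inj₂ _) a≢b b≢c c≢a =
    c≢a (trans (¬-not (≢-sym b≢c)) (sym (¬-not a≢b)))

  girth : t ≢ 1 × t ≢ 3 → Girth G 4
  girth (t≢1 , t≢3) = square , no-short-cycle
    where
    a₁ b₁ a₂ b₂ : V
    a₁ = inj₂ (true , zero)
    b₁ = inj₂ (false , zero)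
    a₂ = inj₂ (true , suc zero)
    b₂ = inj₂ (false , suc zero)
    to-≢ : ∀ {p q} → p ≢ q → to p ≢ to q
    to-≢ p≢q = p≢q ∘ to-injective
    square : HasCycleOfLength G 4
    square = s≤s (s≤s (s≤s z≤n)) , to a₁
           , cons (R⇒Adj {a₁} {b₁} λ ()) (cons (R⇒Adj {b₁} {a₂} λ ()) (cons (R⇒Adj {a₂} {b₂} λ ()) (cons (R⇒Adj {b₂} {a₁} λ ()) (nil _))))
           , (to-≢ {b₁} {a₂} (λ ()) ∷ to-≢ {b₁} {b₂} (λ ()) ∷ to-≢ {b₁} {a₁} (λ ()) ∷ [])
           ∷ (to-≢ {a₂} {b₂} (λ ()) ∷ to-≢ {a₂} {a₁} (λ ()) ∷ [])
           ∷ (to-≢ {b₂} {a₁} (λ ()) ∷ [])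
           ∷ [] ∷ []
    no-short-cycle : ∀ l → l < 4 → ¬ HasCycleOfLength G l
    no-short-cycle 3 _ (_ , _ , cons e₁ (cons e₂ (cons e₃ (nil _))) , _) =
      Edge-triangle-free t≢1 t≢3 _ _ _ (Adj⇒R e₁) (Adj⇒R e₂) (Adj⇒R e₃)
    no-short-cycle 0 _ (() , _)
    no-short-cycle 1 _ (s≤s () , _)
    no-short-cycle 2 _ (s≤s (s≤s ()) , _)
    no-short-cycle (suc (suc (suc (suc _)))) (s≤s (s≤s (s≤s (s≤s ())))) _

  bipartite : 2 ∣ t → Bipartite G
  bipartite 2∣t = colour ∘ from , λ u v e → colour-proper (from u) (from v) (Adj⇒R e)
    where
    odd : Parity → Bool
    odd 0ℙ = false
    odd 1ℙ = true
    colour : V → Bool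
    colour (inj₁ (i , _)) = odd (parity (toℕ i))
    colour (inj₂ (a , _)) = a
    next-flips : ∀ i → odd (parity (toℕ i)) ≢ odd (parity (toℕ (next i)))
    next-flips i rewrite parity-next 2∣t i with parity (toℕ i)
    ... | 0ℙ = λ ()
    ... | 1ℙ = λ ()
    colour-proper : ∀ p q → Edge p q → colour p ≢ colour q
    colour-proper (inj₁ (i , _)) (inj₁ _) (inj₁ (refl , _) , _) = next-flips i
    colour-proper (inj₁ _) (inj₁ (j , _)) (inj₂ (refl , _) , _) = ≢-sym (next-flips j)
    colour-proper (inj₂ _) (inj₂ _) a≢b = a≢b

proposition5 : (t d : ℕ) → 1 ≤ t → 1 ≤ d → 2 ∣ d →
    Σ ℕ (λ n → Σ (Graph n) (λ G →
      MaxDegree G d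
      × ChromaticAtLeast (PowAdj G t) (d ^ t) (2 ^ t)
      × ((t ≢ 1 × t ≢ 3) → Girth G 4)
      × (2 ∣ t → Bipartite G)))
proposition5 zero    _              ()  _  _
proposition5 (suc _) .(0 * 2)       _   () (divides zero refl)
proposition5 (suc t′) .(suc k′ * 2) _ _ (divides (suc k′) refl) =
  N , G , maxDegree , chromatic , girth , bipartite
  where open Construction t′ k′
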